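{- Let $\Theta$ be the linear cellular automaton over the state set $(\mathbb{Z}/2\mathbb{Z})^2$ given by the matrix $\Theta=\begin{pmatrix}0&1\\1&u^{ -1}+1+u\end{pmatrix}\in\mathscr{M}_2(\mathbb{Z}/2\mathbb{Z})[u,u^{ -1}]$. Then $\Theta$ simulates its mirror $\mathrm{mir}\circ\Theta\circ\mathrm{mir}$, its inverse $\Theta^{ -1}$ and its dual $\tilde\Theta=\mathrm{mir}\circ\Theta^{ -1}\circ\mathrm{mir}$, but $\Theta$ does not simulate the identity cellular automaton.
   Context: Linear CA: with state set $R^d$ ($R$ a finite commutative ring), a matrix $M=\sum_k M_k u^k\in\mathscr{M}_d(R)[u,u^{ -1}]$ (finitely many nonzero $M_k\in\mathscr{M}_d(R)$) defines the CA acting on configurations $c\in(R^d)^{\mathbb{Z}}$, viewed as formal series $\sum_x c(x)u^x$, by multiplication: $(M c)(x)=\sum_k M_k\,c(x-k)$. The mirror map is $\mathrm{mir}(c)_z=c_{ -z}$; the dual of a reversible CA $F$ is $\tilde F=\mathrm{mir}\circ F^{ -1}\circ\mathrm{mir}$. Simulation: for a CA $F$ with state set $A$, the shift $\sigma_z$ is $\sigma_z(c)_x=c_{x-z}$, the packing map $b_m:A^{\mathbb{Z}}\to(A^m)^{\mathbb{Z}}$ is $(b_m(c))(z)=(c(mz),\dots,c(mz+m-1))$, and the rescaling $F^{\langle m,t,z\rangle}$ is the CA with global map $b_m\circ\sigma_z\circ F^t\circ b_m^{ -1}$. $G$ (state set $B$) is a sub-automaton of $F$, written $G\sqsubseteq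 F$, if there is an injective $\varphi:B\to A$ with $\overline{\varphi}\circ G=F\circ\overline{\varphi}$ ($\overline{\varphi}$ applied cellwise). $F$ simulates $G$ if there are $m_1,m_2,t_1,t_2\geq1$, $z_1,z_2\in\mathbb{Z}$ with $G^{\langle m_1,t_1,z_1\rangle}\sqsubseteq F^{\langle m_2,t_2,z_2\rangle}$. -}

module Defs where

open import Data.Bool using (Bool; true; false; _xor_; _∧_)
open import Data.Nat as ℕ using (ℕ; zero; suc; NonZero; _≤_)
open import Data.Integer as ℤ using (ℤ; +_; _+_; _-_; _*_; -_)
open import Data.Integer.DivMod using (_/ℕ_; _%ℕ_; n%ℕd<d)
open import Data.Fin using (Fin; toℕ; fromℕ<)
import Data.Fin as Fin
open import Data.Vec using (Vec; tabulate; lookup)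
open import Data.List using (List; foldr; _∷_; [])
open import Data.Product using (Σ; _×_; _,_)
open import Function using (_∘_; id)
open import Function.Definitions using (Injective)
open import Relation.Binary.PropositionalEquality using (_≡_)

Config : Set → Set
Config A = ℤ → A

GMap : Set → Set
GMap A = Config A → Config A

_≗ᶜ_ : {A : Set} → GMap A → GMap A → Set
F ≗ᶜ G = ∀ c x → F c x ≡ G c x

-- Linear CA over R = ℤ/2ℤ (represented as Bool, + = xor, · = ∧)

Mat : ℕ → Set
Mat d = Fin d → Fin d → Bool

-- A Laurent matrix  Σ_k M_k u^k  given as a finite list of terms (k , M_k).
LaurentMat : ℕ → Set
LaurentMat d = List (ℤ × Mat d)

sum₂ : ∀ {d} → (Fin d → Bool) → Bool
sum₂ {zero}  f = false
sum₂ {suc d} f = f Fin.zero xor sum₂ {d} (f ∘ Fin.suc)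

matVec : ∀ {d} → Mat d → Vec Bool d → Vec Bool d
matVec M v = tabulate λ i → sum₂ λ j → M i j ∧ lookup v j

zeroVec : ∀ {d} → Vec Bool d
zeroVec = tabulate λ _ → false

_⊕ᵥ_ : ∀ {d} → Vec Bool d → Vec Bool d → Vec Bool d
u ⊕ᵥ v = tabulate λ i → lookup u i xor lookup v i

linearCA : ∀ {d} → LaurentMat d → GMap (Vec Bool d)
linearCA M c x = foldr (λ { (k , Mk) acc → matVec Mk (c (x - k)) ⊕ᵥ acc }) zeroVec M

mir : {A : Set} → Config A → Config A
mir c z = c (- z)

mirrorCA : {A : Set} → GMap A → GMap A
mirrorCA F = mir ∘ F ∘ mir

shift : {A : Set} → ℤ → Config A → Config A
shift z c x = c (x - z)

iterate : {A : Set} → ℕ → GMap A → GMap A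
iterate zero    F = id
iterate (suc t) F = F ∘ iterate t F

pack : {A : Set} (m : ℕ) → Config A → Config (Vec A m)
pack m c z = tabulate λ i → c (+ m * z + + toℕ i)

unpack : {A : Set} (m : ℕ) .{{_ : NonZero m}} → Config (Vec A m) → Config A
unpack m c x = lookup (c (x /ℕ m)) (fromℕ< (n%ℕd<d x m))

rescale : {A : Set} → GMap A → (m : ℕ) .{{_ : NonZero m}} → ℕ → ℤ → GMap (Vec A m)
rescale F m t z = pack m ∘ shift z ∘ iterate t F ∘ unpack m

SubAutomaton : {A B : Set} → GMap B → GMap A → Set
SubAutomaton {A} {B} G F =
  Σ (B → A) λ φ → Injective _≡_ _≡_ φ × (∀ c x → φ (G c x) ≡ F (φ ∘ c) x)

Simulates : {A B : Set} → GMap A → GMap B → Set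
Simulates F G =
  Σ ℕ λ m₁ → Σ (NonZero m₁) λ nz₁ → Σ ℕ λ m₂ → Σ (NonZero m₂) λ nz₂ →
  Σ ℕ λ t₁ → Σ ℕ λ t₂ → Σ ℤ λ z₁ → Σ ℤ λ z₂ →
    (1 ≤ t₁) × (1 ≤ t₂) ×
    SubAutomaton (rescale G m₁ {{nz₁}} t₁ z₁) (rescale F m₂ {{nz₂}} t₂ z₂)

mat : Bool → Bool → Bool → Bool → Mat 2
mat a b c d Fin.zero Fin.zero = a
mat a b c d Fin.zero (Fin.suc Fin.zero) = b
mat a b c d (Fin.suc Fin.zero) Fin.zero = c
mat a b c d (Fin.suc Fin.zero) (Fin.suc Fin.zero) = d

ΘMat : LaurentMat 2
ΘMat = (- + 1 , mat false false false true)
     ∷ (+ 0 , mat false true true true)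
     ∷ (+ 1 , mat false false false true)
     ∷ []

Θ : GMap (Vec Bool 2)
Θ = linearCA ΘMat

idCA : (B : Set) → GMap B
idCA B = id

-- Θ commutes with the mirror, and swapping the two components of a state conjugates Θ to its
-- inverse, so both simulations are cellwise. If Θ simulated an identity automaton, every
-- configuration in the image of the simulation would satisfy Θ^T E = σ_k E for fixed T ≥ 1 and k.
-- Marking one block of a simulated configuration yields two such orbits differing on finitely many
-- cells; by linearity their difference D ≠ 0 is finitely supported with Θ^T D = σ_k D. Writing the
-- orbit as the recurrence r_{t+2} = r_t + (u⁻¹ + 1 + u) r_{t+1}, this is impossible: for |k| > T the
-- support outruns the light cone; for |k| < T the zeros on one side of the support spread at the
-- speed of light and swallow it; for |k| = T, in the co-moving frame, the columns next to the edge
-- of the support have leading differences Δ^j forced to be constantly 1, while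
-- Δ^(2^a) g = g + S^(2^a) g is incompatible with a period that is an odd multiple of 2^a.

module Submission where

open import Defs
open import Data.Bool using (Bool)
open import Data.Nat using (ℕ; _≤_)
open import Data.Fin using (Fin)
open import Data.Vec using (Vec)
open import Data.Product using (_×_)
open import Function using (_∘_; id)
open import Relation.Nullary using (¬_)

open import Data.Bool using (true; false; not; _xor_)
open import Data.Bool.Properties using (_≟_; xor-same; not-involutive; not-¬; ¬-not)
open import Data.Bool.Solver using (module xor-∧-Solver)
open import Data.Nat as ℕ using (zero; suc; _<_; s≤s; z≤n; NonZero)
import Data.Nat.Properties as ℕₚ
open import Data.Nat.DivMod using (_/_; _%_; m≡m%n+[m/n]*n; m%n<n)
open import Data.Nat.Induction using (<-rec)
open import Data.Fin as Fin using (toℕ; fromℕ<)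
import Data.Fin.Properties as Finₚ
open import Data.Vec using (_∷_; []; lookup; tabulate; replicate; map; head)
import Data.Vec.Properties as Vecₚ
open import Data.Product using (Σ; _,_; proj₁; proj₂)
open import Data.Sum using (_⊎_; inj₁; inj₂)
open import Data.Empty using (⊥; ⊥-elim)
open import Function.Definitions using (Injective)
open import Relation.Nullary using (yes; no; contradiction)
open import Relation.Binary.Definitions using (tri<; tri≈; tri>)
open import Relation.Binary.PropositionalEquality

xor-interchange : ∀ a b c d → (a xor b) xor (c xor d) ≡ (a xor c) xor (b xor d)
xor-interchange = solve 4 (λ a b c d → (a :+ b) :+ (c :+ d) := (a :+ c) :+ (b :+ d)) refl
  where open xor-∧-Solver

module _ where
  open import Data.Nat using (_+_; _*_; _^_)
  open import Data.Nat.Tactic.RingSolver using (solve-∀)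

  Δ : (ℕ → Bool) → ℕ → Bool
  Δ f n = f n xor f (suc n)

  Δ^ : ℕ → (ℕ → Bool) → ℕ → Bool
  Δ^ zero    f = f
  Δ^ (suc j) f = Δ^ j (Δ f)

  Δ^-cong : ∀ j {f g} → (∀ n → f n ≡ g n) → ∀ n → Δ^ j f n ≡ Δ^ j g n
  Δ^-cong zero    f≗g n = f≗g n
  Δ^-cong (suc j) f≗g n = Δ^-cong j (λ m → cong₂ _xor_ (f≗g m) (f≗g (suc m))) n

  Δ^-xor : ∀ j f g n → Δ^ j (λ m → f m xor g m) n ≡ Δ^ j f n xor Δ^ j g n
  Δ^-xor zero    f g n = refl
  Δ^-xor (suc j) f g n = trans
    (Δ^-cong j (λ m → xor-interchange (f m) (g m) (f (suc m)) (g (suc m))) n)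
    (Δ^-xor j (Δ f) (Δ g) n)

  Δ^-suc : ∀ j f n → Δ^ j (f ∘ suc) n ≡ Δ^ j f (suc n)
  Δ^-suc zero    f n = refl
  Δ^-suc (suc j) f n = Δ^-suc j (Δ f) n

  Δ^-outer : ∀ j f n → Δ^ (suc j) f n ≡ Δ (Δ^ j f) n
  Δ^-outer zero    f n = refl
  Δ^-outer (suc j) f n = Δ^-outer j (Δ f) n

  Δ^-+ : ∀ i j f n → Δ^ (i + j) f n ≡ Δ^ i (Δ^ j f) n
  Δ^-+ zero    j f n = refl
  Δ^-+ (suc i) j f n = trans (Δ^-+ i j (Δ f) n) (Δ^-cong i (Δ^-outer j f) n)

  Δ^-periodic : ∀ j {f} T → (∀ n → f (n + T) ≡ f n) → ∀ n → Δ^ j f (n + T) ≡ Δ^ j f n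
  Δ^-periodic zero    T per n = per n
  Δ^-periodic (suc j) T per n = Δ^-periodic j T (λ m → cong₂ _xor_ (per m) (per (suc m))) n

  Δ^-pow2 : ∀ a f n → Δ^ (2 ^ a) f n ≡ f n xor f (n + 2 ^ a)
  Δ^-pow2 zero    f n = cong (λ m → f n xor f m) (ℕₚ.+-comm 1 n)
  Δ^-pow2 (suc a) f n = begin
    Δ^ (2 ^ suc a) f n                              ≡⟨ cong (λ j → Δ^ j f n) (double N) ⟩
    Δ^ (N + N) f n                                  ≡⟨ Δ^-+ N N f n ⟩
    Δ^ N (Δ^ N f) n                                 ≡⟨ Δ^-pow2 a (Δ^ N f) n ⟩
    Δ^ N f n xor Δ^ N f (n + N)                     ≡⟨ cong₂ _xor_ (Δ^-pow2 a f n) (Δ^-pow2 a f (n + N)) ⟩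
    (f n xor f (n + N)) xor (f (n + N) xor f (n + N + N))  ≡⟨ telescope (f n) (f (n + N)) (f (n + N + N)) ⟩
    f n xor f (n + N + N)                           ≡⟨ cong (λ m → f n xor f m) (reassoc n N) ⟩
    f n xor f (n + 2 ^ suc a)                       ∎
    where
    open ≡-Reasoning
    N = 2 ^ a
    double : ∀ k → 2 * k ≡ k + k
    double = solve-∀
    reassoc : ∀ n k → n + k + k ≡ n + 2 * k
    reassoc = solve-∀
    telescope : ∀ x y z → (x xor y) xor (y xor z) ≡ x xor z
    telescope = solve 3 (λ x y z → (x :+ y) :+ (y :+ z) := x :+ z) refl
      where open xor-∧-Solver

  half-or-odd : ∀ n → Σ ℕ λ h → n ≡ h + h ⊎ n ≡ suc (h + h)
  half-or-odd zero    = 0 , inj₁ refl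
  half-or-odd (suc n) with half-or-odd n
  ... | h , inj₁ n≡2h   = h , inj₂ (cong suc n≡2h)
  ... | h , inj₂ n≡2h+1 = suc h , inj₁ (cong suc (trans n≡2h+1 (sym (ℕₚ.+-suc h h))))

  pow2-times-odd : ∀ n → 1 ≤ n → Σ ℕ λ a → Σ ℕ λ r → n ≡ 2 ^ a * suc (r + r)
  pow2-times-odd = <-rec _ go
    where
    go : ∀ n → (∀ {m} → m < n → 1 ≤ m → Σ ℕ λ a → Σ ℕ λ r → m ≡ 2 ^ a * suc (r + r)) →
         1 ≤ n → Σ ℕ λ a → Σ ℕ λ r → n ≡ 2 ^ a * suc (r + r)
    go n rec 1≤n with half-or-odd n
    ... | h , inj₂ n≡2h+1 = 0 , h , trans n≡2h+1 (sym (ℕₚ.+-identityʳ _))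
    ... | zero , inj₁ refl with () ← 1≤n
    ... | suc h , inj₁ refl with rec (ℕₚ.m<m+n (suc h) (s≤s z≤n)) (s≤s z≤n)
    ...   | a , r , h≡ = suc a , r , trans (cong₂ _+_ h≡ h≡) (e (2 ^ a) (suc (r + r)))
      where
      e : ∀ p q → p * q + p * q ≡ 2 * p * q
      e = solve-∀

  antiperiodic-odd-period : ∀ (g : ℕ → Bool) a r → (∀ n → g (n + 2 ^ a) ≡ not (g n)) →
    (∀ n → g (n + 2 ^ a * suc (r + r)) ≡ g n) → ⊥
  antiperiodic-odd-period g a r anti per = not-¬ refl (begin
    g 0                           ≡⟨ per 0 ⟨
    g (2 ^ a * suc (r + r))       ≡⟨ cong g (e N r) ⟩
    g (r * (N + N) + N)           ≡⟨ anti (r * (N + N)) ⟩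
    not (g (r * (N + N)))         ≡⟨ cong not (even-multiples r) ⟩
    not (g 0)                     ∎)
    where
    open ≡-Reasoning
    N = 2 ^ a
    e : ∀ p r → p * suc (r + r) ≡ r * (p + p) + p
    e = solve-∀
    e′ : ∀ i p → p + p + i * (p + p) ≡ i * (p + p) + p + p
    e′ = solve-∀
    even-multiples : ∀ i → g (i * (N + N)) ≡ g 0
    even-multiples zero    = refl
    even-multiples (suc i) = begin
      g (N + N + i * (N + N))      ≡⟨ cong g (e′ i N) ⟩
      g (i * (N + N) + N + N)      ≡⟨ anti _ ⟩
      not (g (i * (N + N) + N))    ≡⟨ cong not (anti _) ⟩
      not (not (g (i * (N + N))))  ≡⟨ not-involutive _ ⟩
      g (i * (N + N))              ≡⟨ even-multiples i ⟩
      g 0                          ∎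

  periodic-extend : ∀ (h : ℕ → Bool) {v} T → 1 ≤ T → (∀ n → h (n + T) ≡ h n) →
    (∀ n → h (suc n) ≡ v) → ∀ n → h n ≡ v
  periodic-extend h (suc T) _ per h-suc zero    = trans (sym (per 0)) (h-suc T)
  periodic-extend h T       _ per h-suc (suc n) = h-suc n

  xor-true : ∀ x y → x xor y ≡ true → y ≡ not x
  xor-true false y eq = eq
  xor-true true  y eq = trans (sym (not-involutive y)) (cong not eq)

  -- The columns C j, counted from the right, of a space-time diagram of Θ seen from a frame moving
  -- at the speed of light, starting with two zero columns: the leading differences Δ^j C (j+2) are
  -- forced to be identically true, which no time period survives.
  module LightSpeedColumns (C : ℕ → ℕ → Bool) (T : ℕ) (1≤T : 1 ≤ T)
    (periodic : ∀ j n → C j (n + T) ≡ C j n)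
    (C₀-zero : ∀ n → C 0 n ≡ false) (C₁-zero : ∀ n → C 1 n ≡ false)
    (recurrence : ∀ j n → C (suc (suc j)) (suc (suc n)) ≡
                          C j n xor (C j (suc n) xor (C (suc j) (suc n) xor C (suc (suc j)) (suc n))))
    (C₂-nonzero : Σ ℕ λ n → C 2 n ≡ true) where

    Δ-column : ∀ j n → Δ (C (suc (suc j))) (suc n) ≡ C (suc j) (suc n) xor Δ (C j) n
    Δ-column j n = trans (cong (C (suc (suc j)) (suc n) xor_) (recurrence j n))
      (cancel (C (suc (suc j)) (suc n)) (C j n) (C j (suc n)) (C (suc j) (suc n)))
      where
      cancel : ∀ x a b d → x xor (a xor (b xor (d xor x))) ≡ d xor (a xor b)
      cancel = solve 4 (λ x a b d → x :+ (a :+ (b :+ (d :+ x))) := d :+ (a :+ b)) refl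
        where open xor-∧-Solver

    extend : ∀ {h : ℕ → Bool} {v} j → (∀ n → h (n + T) ≡ h n) → (∀ n → Δ^ j h (suc n) ≡ v) → ∀ n → Δ^ j h n ≡ v
    extend {h} j per = periodic-extend (Δ^ j h) T 1≤T (Δ^-periodic j T per)

    C₂-constant : ∀ n → C 2 n ≡ C 2 1
    C₂-constant = periodic-extend (C 2) T 1≤T (periodic 2) step
      where
      open ≡-Reasoning
      step : ∀ n → C 2 (suc n) ≡ C 2 1
      step zero    = refl
      step (suc n) = begin
        C 2 (suc (suc n))                                           ≡⟨ recurrence 0 n ⟩
        C 0 n xor (C 0 (suc n) xor (C 1 (suc n) xor C 2 (suc n)))
          ≡⟨ cong₂ (λ p q → p xor (q xor (C 1 (suc n) xor C 2 (suc n)))) (C₀-zero n) (C₀-zero (suc n)) ⟩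
        C 1 (suc n) xor C 2 (suc n)                                  ≡⟨ cong (_xor C 2 (suc n)) (C₁-zero (suc n)) ⟩
        C 2 (suc n)                                                  ≡⟨ step n ⟩
        C 2 1                                                        ∎

    leading : ∀ j → (∀ n → Δ^ j (C (2 + j)) n ≡ true) × (∀ n → Δ^ (suc j) (C (suc j)) n ≡ false)
    leading zero = (λ n → trans (C₂-constant n) (trans (sym (C₂-constant n₀)) Cn₀)) ,
                   (λ n → cong₂ _xor_ (C₁-zero n) (C₁-zero (suc n)))
      where
      n₀ = proj₁ C₂-nonzero
      Cn₀ = proj₂ C₂-nonzero
    leading (suc j) = extend (suc j) (periodic (3 + j)) next , vanish
      where
      open ≡-Reasoning
      IH = leading j
      next : ∀ n → Δ^ (suc j) (C (3 + j)) (suc n) ≡ true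
      next n = begin
        Δ^ j (Δ (C (3 + j))) (suc n)                                 ≡⟨ Δ^-suc j (Δ (C (3 + j))) n ⟨
        Δ^ j (λ m → Δ (C (3 + j)) (suc m)) n                        ≡⟨ Δ^-cong j (Δ-column (suc j)) n ⟩
        Δ^ j (λ m → C (2 + j) (suc m) xor Δ (C (suc j)) m) n        ≡⟨ Δ^-xor j (λ m → C (2 + j) (suc m)) (Δ (C (suc j))) n ⟩
        Δ^ j (λ m → C (2 + j) (suc m)) n xor Δ^ (suc j) (C (suc j)) n
          ≡⟨ cong₂ _xor_ (trans (Δ^-suc j (C (2 + j)) n) (proj₁ IH (suc n))) (proj₂ IH n) ⟩
        true                                                          ∎
      vanish : ∀ n → Δ^ (2 + j) (C (2 + j)) n ≡ false
      vanish n = begin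
        Δ^ (2 + j) (C (2 + j)) n                                 ≡⟨ Δ^-outer (suc j) (C (2 + j)) n ⟩
        Δ (Δ^ (suc j) (C (2 + j))) n
          ≡⟨ cong₂ _xor_ (Δ^-outer j (C (2 + j)) n) (Δ^-outer j (C (2 + j)) (suc n)) ⟩
        Δ (Δ (Δ^ j (C (2 + j)))) n                               ≡⟨ cong₂ _xor_ (cong₂ _xor_ (proj₁ IH n) (proj₁ IH (suc n)))
                                                                           (cong₂ _xor_ (proj₁ IH (suc n)) (proj₁ IH (2 + n))) ⟩
        false                                                     ∎

    impossible : ⊥
    impossible with pow2-times-odd T 1≤T
    ... | a , r , T≡ = antiperiodic-odd-period g a r antiperiodic period
      where
      g = C (2 + 2 ^ a)
      antiperiodic : ∀ n → g (n + 2 ^ a) ≡ not (g n)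
      antiperiodic n = xor-true (g n) _ (trans (sym (Δ^-pow2 a g n)) (proj₁ (leading (2 ^ a)) n))
      period : ∀ n → g (n + 2 ^ a * suc (r + r)) ≡ g n
      period n = trans (cong (λ t → g (n + t)) (sym T≡)) (periodic (2 + 2 ^ a) n)

open import Data.Integer as ℤ using (ℤ; +_; -[1+_]; _+_; _-_; -_; _*_)
import Data.Integer.Properties as ℤₚ
open import Data.Integer.DivMod using (_/ℕ_; _%ℕ_; n%ℕd<d; a≡a%ℕn+[a/ℕn]*n)
open import Data.Integer.Tactic.RingSolver using (solve-∀)

Congruent : {A : Set} → GMap A → Set
Congruent F = ∀ {c c′} → (∀ y → c y ≡ c′ y) → ∀ x → F c x ≡ F c′ x

π₀ π₁ : Vec Bool 2 → Bool
π₀ v = lookup v Fin.zero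
π₁ v = lookup v (Fin.suc Fin.zero)

pair-η : (v : Vec Bool 2) → π₀ v ∷ π₁ v ∷ [] ≡ v
pair-η (_ ∷ _ ∷ []) = refl

spread : (ℤ → Bool) → ℤ → Bool
spread f x = f (x + + 1) xor (f x xor f (x - + 1))

spread-cong : ∀ {f g} → (∀ y → f y ≡ g y) → ∀ x → spread f x ≡ spread g x
spread-cong f≗g x = cong₂ _xor_ (f≗g _) (cong₂ _xor_ (f≗g x) (f≗g _))

spread-xor : ∀ f g x → spread (λ y → f y xor g y) x ≡ spread f x xor spread g x
spread-xor f g x =
  trans (cong ((F xor G) xor_) (xor-interchange (f x) (g x) (f (x - + 1)) (g (x - + 1))))
        (xor-interchange F G (f x xor f (x - + 1)) (g x xor g (x - + 1)))
  where
  F = f (x + + 1)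
  G = g (x + + 1)

spread-shift : ∀ z f x → spread (shift z f) x ≡ spread f (x - z)
spread-shift z f x = cong₂ _xor_ (cong f (e₁ x z)) (cong (f (x - z) xor_) (cong f (e₂ x z)))
  where
  e₁ : ∀ x z → x + + 1 - z ≡ x - z + + 1
  e₁ = solve-∀
  e₂ : ∀ x z → x - + 1 - z ≡ x - z - + 1
  e₂ = solve-∀

spread-mir : ∀ f x → spread (mir f) x ≡ spread f (- x)
spread-mir f x = trans (cong₂ (λ l r → f l xor (f (- x) xor f r)) (e₁ x) (e₂ x))
                       (outer-swap (f (- x - + 1)) (f (- x)) (f (- x + + 1)))
  where
  e₁ : ∀ x → - (x + + 1) ≡ - x - + 1
  e₁ = solve-∀
  e₂ : ∀ x → - (x - + 1) ≡ - x + + 1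
  e₂ = solve-∀
  outer-swap : ∀ l m r → l xor (m xor r) ≡ r xor (m xor l)
  outer-swap = solve 3 (λ l m r → l :+ (m :+ r) := r :+ (m :+ l)) refl
    where open xor-∧-Solver

Θ-components : ∀ c x → Θ c x ≡ π₁ (c x) ∷ (π₀ (c x) xor spread (π₁ ∘ c) x) ∷ []
Θ-components c x rewrite ℤₚ.+-identityʳ x = rule (c (x + + 1)) (c x) (c (x - + 1))
  where
  rule : ∀ l m r →
    matVec (mat false false false true) l ⊕ᵥ (matVec (mat false true true true) m ⊕ᵥ
      (matVec (mat false false false true) r ⊕ᵥ zeroVec))
    ≡ π₁ m ∷ (π₀ m xor (π₁ l xor (π₁ m xor π₁ r))) ∷ []
  rule (_ ∷ false ∷ []) (false ∷ false ∷ []) (_ ∷ false ∷ []) = refl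
  rule (_ ∷ false ∷ []) (false ∷ false ∷ []) (_ ∷ true ∷ []) = refl
  rule (_ ∷ false ∷ []) (false ∷ true ∷ []) (_ ∷ false ∷ []) = refl
  rule (_ ∷ false ∷ []) (false ∷ true ∷ []) (_ ∷ true ∷ []) = refl
  rule (_ ∷ false ∷ []) (true ∷ false ∷ []) (_ ∷ false ∷ []) = refl
  rule (_ ∷ false ∷ []) (true ∷ false ∷ []) (_ ∷ true ∷ []) = refl
  rule (_ ∷ false ∷ []) (true ∷ true ∷ []) (_ ∷ false ∷ []) = refl
  rule (_ ∷ false ∷ []) (true ∷ true ∷ []) (_ ∷ true ∷ []) = refl
  rule (_ ∷ true ∷ []) (false ∷ false ∷ []) (_ ∷ false ∷ []) = refl
  rule (_ ∷ true ∷ []) (false ∷ false ∷ []) (_ ∷ true ∷ []) = refl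
  rule (_ ∷ true ∷ []) (false ∷ true ∷ []) (_ ∷ false ∷ []) = refl
  rule (_ ∷ true ∷ []) (false ∷ true ∷ []) (_ ∷ true ∷ []) = refl
  rule (_ ∷ true ∷ []) (true ∷ false ∷ []) (_ ∷ false ∷ []) = refl
  rule (_ ∷ true ∷ []) (true ∷ false ∷ []) (_ ∷ true ∷ []) = refl
  rule (_ ∷ true ∷ []) (true ∷ true ∷ []) (_ ∷ false ∷ []) = refl
  rule (_ ∷ true ∷ []) (true ∷ true ∷ []) (_ ∷ true ∷ []) = refl

Θ-cong : Congruent Θ
Θ-cong {c} {c′} c≗c′ x = begin
  Θ c x                                                  ≡⟨ Θ-components c x ⟩
  π₁ (c x) ∷ (π₀ (c x) xor spread (π₁ ∘ c) x) ∷ []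
    ≡⟨ cong₂ (λ v s → π₁ v ∷ (π₀ v xor s) ∷ []) (c≗c′ x) (spread-cong (cong π₁ ∘ c≗c′) x) ⟩
  π₁ (c′ x) ∷ (π₀ (c′ x) xor spread (π₁ ∘ c′) x) ∷ []    ≡⟨ Θ-components c′ x ⟨
  Θ c′ x                                                 ∎
  where open ≡-Reasoning

Θ-shift : ∀ z c x → Θ (shift z c) x ≡ Θ c (x - z)
Θ-shift z c x = begin
  Θ (shift z c) x                                               ≡⟨ Θ-components (shift z c) x ⟩
  π₁ (c (x - z)) ∷ (π₀ (c (x - z)) xor spread (shift z (π₁ ∘ c)) x) ∷ []
    ≡⟨ cong (λ s → π₁ (c (x - z)) ∷ (π₀ (c (x - z)) xor s) ∷ []) (spread-shift z (π₁ ∘ c) x) ⟩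
  π₁ (c (x - z)) ∷ (π₀ (c (x - z)) xor spread (π₁ ∘ c) (x - z)) ∷ []   ≡⟨ Θ-components c (x - z) ⟨
  Θ c (x - z)                                                   ∎
  where open ≡-Reasoning

Θ-mirror : ∀ c x → mirrorCA Θ c x ≡ Θ c x
Θ-mirror c x = begin
  Θ (mir c) (- x)                                               ≡⟨ Θ-components (mir c) (- x) ⟩
  π₁ (c (- - x)) ∷ (π₀ (c (- - x)) xor spread (mir (π₁ ∘ c)) (- x)) ∷ []
    ≡⟨ cong (λ s → π₁ (c (- - x)) ∷ (π₀ (c (- - x)) xor s) ∷ []) (spread-mir (π₁ ∘ c) (- x)) ⟩
  π₁ (c (- - x)) ∷ (π₀ (c (- - x)) xor spread (π₁ ∘ c) (- - x)) ∷ []  ≡⟨ Θ-components c (- - x) ⟨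
  Θ c (- - x)                                                   ≡⟨ cong (Θ c) (ℤₚ.neg-involutive x) ⟩
  Θ c x                                                         ∎
  where open ≡-Reasoning

simulates-cellwise : ∀ {A B : Set} {F : GMap A} {G : GMap B} (ψ : B → A) → Injective _≡_ _≡_ ψ →
  Congruent F → (∀ c y → ψ (G c y) ≡ F (ψ ∘ c) y) → Simulates F G
simulates-cellwise {F = F} {G} ψ ψ-inj F-cong ψ-commutes =
  1 , _ , 1 , _ , 1 , 1 , + 0 , + 0 , s≤s z≤n , s≤s z≤n , map ψ , map-inj , map-commutes
  where
  map-inj : Injective _≡_ _≡_ (map ψ)
  map-inj {_ ∷ []} {_ ∷ []} eq = cong (_∷ []) (ψ-inj (cong head eq))
  map-commutes : ∀ c x → map ψ (rescale G 1 1 (+ 0) c x) ≡ rescale F 1 1 (+ 0) (map ψ ∘ c) x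
  map-commutes c x = cong (_∷ [])
    (trans (ψ-commutes (unpack 1 c) _) (F-cong (λ y → sym (Vecₚ.lookup-map _ ψ (c _))) _))

swap : Vec Bool 2 → Vec Bool 2
swap v = π₁ v ∷ π₀ v ∷ []

swap-involutive : ∀ v → swap (swap v) ≡ v
swap-involutive = pair-η

swap-injective : Injective _≡_ _≡_ swap
swap-injective {u} {v} eq = begin
  u               ≡⟨ swap-involutive u ⟨
  swap (swap u)   ≡⟨ cong swap eq ⟩
  swap (swap v)   ≡⟨ swap-involutive v ⟩
  v               ∎
  where open ≡-Reasoning

swap-Θ-swap-Θ : ∀ d y → swap (Θ (swap ∘ Θ d) y) ≡ d y
swap-Θ-swap-Θ d y = begin
  swap (Θ (swap ∘ Θ d) y)                                     ≡⟨ cong swap (Θ-components (swap ∘ Θ d) y) ⟩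
  (π₁ (Θ d y) xor spread (π₀ ∘ Θ d) y) ∷ π₀ (Θ d y) ∷ []
    ≡⟨ cong (λ e → (π₁ e xor spread (π₀ ∘ Θ d) y) ∷ π₀ e ∷ []) (Θ-components d y) ⟩
  ((π₀ (d y) xor s) xor spread (π₀ ∘ Θ d) y) ∷ π₁ (d y) ∷ []
    ≡⟨ cong (λ t → ((π₀ (d y) xor s) xor t) ∷ π₁ (d y) ∷ []) (spread-cong (λ z → cong π₀ (Θ-components d z)) y) ⟩
  ((π₀ (d y) xor s) xor s) ∷ π₁ (d y) ∷ []                     ≡⟨ cong (λ b → b ∷ π₁ (d y) ∷ []) (cancel (π₀ (d y)) s) ⟩
  π₀ (d y) ∷ π₁ (d y) ∷ []                                     ≡⟨ pair-η (d y) ⟩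
  d y                                                          ∎
  where
  open ≡-Reasoning
  s = spread (π₁ ∘ d) y
  cancel : ∀ a s → (a xor s) xor s ≡ a
  cancel = solve 2 (λ a s → (a :+ s) :+ s := a) refl
    where open xor-∧-Solver

swap-conjugates-right-inverse : ∀ (Θinv : GMap (Vec Bool 2)) → (Θ ∘ Θinv) ≗ᶜ id →
  ∀ c y → swap (Θinv c y) ≡ Θ (swap ∘ c) y
swap-conjugates-right-inverse Θinv Θ∘Θinv≗id c y = begin
  swap (Θinv c y)                              ≡⟨ cong swap (swap-Θ-swap-Θ (Θinv c) y) ⟨
  swap (swap (Θ (swap ∘ Θ (Θinv c)) y))        ≡⟨ swap-involutive _ ⟩
  Θ (swap ∘ Θ (Θinv c)) y                      ≡⟨ Θ-cong (cong swap ∘ Θ∘Θinv≗id c) y ⟩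
  Θ (swap ∘ c) y                               ∎
  where open ≡-Reasoning

Θ-simulates-mirror : Simulates Θ (mirrorCA Θ)
Θ-simulates-mirror = simulates-cellwise id (λ eq → eq) Θ-cong Θ-mirror

Θ-simulates-inverse : ∀ (Θinv : GMap (Vec Bool 2)) → (Θ ∘ Θinv) ≗ᶜ id →
  Simulates Θ Θinv × Simulates Θ (mirrorCA Θinv)
Θ-simulates-inverse Θinv Θ∘Θinv≗id =
  simulates-cellwise swap swap-injective Θ-cong conj ,
  simulates-cellwise swap swap-injective Θ-cong (λ c y → trans (conj (mir c) (- y)) (Θ-mirror (swap ∘ c) y))
  where conj = swap-conjugates-right-inverse Θinv Θ∘Θinv≗id

rows : (ℤ → Bool) → (ℤ → Bool) → ℕ → ℤ → Bool
rows a b zero          x = a x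
rows a b (suc zero)    x = b x
rows a b (suc (suc n)) x = rows a b n x xor spread (rows a b (suc n)) x

iterate-Θ : ∀ E t x → iterate t Θ E x ≡ rows (π₀ ∘ E) (π₁ ∘ E) t x ∷ rows (π₀ ∘ E) (π₁ ∘ E) (suc t) x ∷ []
iterate-Θ E zero    x = sym (pair-η (E x))
iterate-Θ E (suc t) x = begin
  Θ (iterate t Θ E) x                                             ≡⟨ Θ-components (iterate t Θ E) x ⟩
  π₁ (iterate t Θ E x) ∷ (π₀ (iterate t Θ E x) xor spread (π₁ ∘ iterate t Θ E) x) ∷ []
    ≡⟨ cong₂ (λ v s → π₁ v ∷ (π₀ v xor s) ∷ []) (iterate-Θ E t x) (spread-cong (cong π₁ ∘ iterate-Θ E t) x) ⟩
  rows a b (suc t) x ∷ rows a b (suc (suc t)) x ∷ []              ∎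
  where
  open ≡-Reasoning
  a = π₀ ∘ E
  b = π₁ ∘ E

rows-cong : ∀ {a a′ b b′} → (∀ y → a y ≡ a′ y) → (∀ y → b y ≡ b′ y) → ∀ n x → rows a b n x ≡ rows a′ b′ n x
rows-cong a≗a′ b≗b′ zero          x = a≗a′ x
rows-cong a≗a′ b≗b′ (suc zero)    x = b≗b′ x
rows-cong a≗a′ b≗b′ (suc (suc n)) x =
  cong₂ _xor_ (rows-cong a≗a′ b≗b′ n x) (spread-cong (rows-cong a≗a′ b≗b′ (suc n)) x)

rows-+ : ∀ a b n t x → rows a b (n ℕ.+ t) x ≡ rows (rows a b t) (rows a b (suc t)) n x
rows-+ a b zero          t x = refl
rows-+ a b (suc zero)    t x = refl
rows-+ a b (suc (suc n)) t x =
  cong₂ _xor_ (rows-+ a b n t x) (spread-cong (rows-+ a b (suc n) t) x)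

rows-shift : ∀ z a b n x → rows (shift z a) (shift z b) n x ≡ rows a b n (x - z)
rows-shift z a b zero          x = refl
rows-shift z a b (suc zero)    x = refl
rows-shift z a b (suc (suc n)) x = cong₂ _xor_ (rows-shift z a b n x)
  (trans (spread-cong (rows-shift z a b (suc n)) x) (spread-shift z (rows a b (suc n)) x))

rows-mir : ∀ a b n x → rows (mir a) (mir b) n x ≡ rows a b n (- x)
rows-mir a b zero          x = refl
rows-mir a b (suc zero)    x = refl
rows-mir a b (suc (suc n)) x = cong₂ _xor_ (rows-mir a b n x)
  (trans (spread-cong (rows-mir a b (suc n)) x) (spread-mir (rows a b (suc n)) x))

rows-xor : ∀ a b a′ b′ n x →
  rows (λ y → a y xor a′ y) (λ y → b y xor b′ y) n x ≡ rows a b n x xor rows a′ b′ n x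
rows-xor a b a′ b′ zero          x = refl
rows-xor a b a′ b′ (suc zero)    x = refl
rows-xor a b a′ b′ (suc (suc n)) x = begin
  rows⊕ n x xor spread (rows⊕ (suc n)) x
    ≡⟨ cong₂ _xor_ (rows-xor a b a′ b′ n x) (spread-cong (rows-xor a b a′ b′ (suc n)) x) ⟩
  (rows a b n x xor rows a′ b′ n x) xor spread (λ y → rows a b (suc n) y xor rows a′ b′ (suc n) y) x
    ≡⟨ cong ((rows a b n x xor rows a′ b′ n x) xor_) (spread-xor (rows a b (suc n)) (rows a′ b′ (suc n)) x) ⟩
  (rows a b n x xor rows a′ b′ n x) xor (spread (rows a b (suc n)) x xor spread (rows a′ b′ (suc n)) x)
    ≡⟨ xor-interchange (rows a b n x) (rows a′ b′ n x) (spread (rows a b (suc n)) x) (spread (rows a′ b′ (suc n)) x) ⟩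
  rows a b (suc (suc n)) x xor rows a′ b′ (suc (suc n)) x  ∎
  where
  open ≡-Reasoning
  rows⊕ = rows (λ y → a y xor a′ y) (λ y → b y xor b′ y)

module PeriodicRows {a b : ℤ → Bool} {T : ℕ} {k : ℤ}
  (period₀ : ∀ x → rows a b T x ≡ a (x - k))
  (period₁ : ∀ x → rows a b (suc T) x ≡ b (x - k)) where

  rows-period : ∀ n x → rows a b (n ℕ.+ T) x ≡ rows a b n (x - k)
  rows-period n x = begin
    rows a b (n ℕ.+ T) x                          ≡⟨ rows-+ a b n T x ⟩
    rows (rows a b T) (rows a b (suc T)) n x      ≡⟨ rows-cong period₀ period₁ n x ⟩
    rows (shift k a) (shift k b) n x              ≡⟨ rows-shift k a b n x ⟩
    rows a b n (x - k)                            ∎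
    where open ≡-Reasoning

  rows-periods : ∀ j n x → rows a b (n ℕ.+ j ℕ.* T) x ≡ rows a b n (x - + j ℤ.* k)
  rows-periods zero    n x = cong₂ (rows a b) (ℕₚ.+-identityʳ n) (e x k)
    where
    e : ∀ x k → x ≡ x - + 0 ℤ.* k
    e = solve-∀
  rows-periods (suc j) n x = begin
    rows a b (n ℕ.+ (T ℕ.+ j ℕ.* T)) x             ≡⟨ cong (λ t → rows a b t x) (reassoc n T (j ℕ.* T)) ⟩
    rows a b (n ℕ.+ j ℕ.* T ℕ.+ T) x               ≡⟨ rows-period (n ℕ.+ j ℕ.* T) x ⟩
    rows a b (n ℕ.+ j ℕ.* T) (x - k)               ≡⟨ rows-periods j n (x - k) ⟩
    rows a b n (x - k - + j ℤ.* k)                 ≡⟨ cong (rows a b n) (e x k (+ j)) ⟩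
    rows a b n (x - + suc j ℤ.* k)                 ∎
    where
    open ≡-Reasoning
    reassoc : ∀ n t s → n ℕ.+ (t ℕ.+ s) ≡ n ℕ.+ s ℕ.+ t
    reassoc n t s = trans (cong (n ℕ.+_) (ℕₚ.+-comm t s)) (sym (ℕₚ.+-assoc n s t))
    e : ∀ x k j → x - k - j ℤ.* k ≡ x - (+ 1 + j) ℤ.* k
    e = solve-∀

compare-witness : ∀ x y → (Σ ℕ λ p → y ≡ x + + p) ⊎ (Σ ℕ λ p → x ≡ y + + suc p)
compare-witness x y with y - x in eq
... | + p      = inj₁ (p , trans (e y x) (cong (λ w → x + w) eq))
  where
  e : ∀ y x → y ≡ x + (y - x)
  e = solve-∀
... | -[1+ p ] = inj₂ (p , trans (e x y) (cong (λ w → y - w) eq))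
  where
  e : ∀ x y → x ≡ y - (y - x)
  e = solve-∀

catch-up : ∀ x y → Σ ℕ λ j → Σ ℕ λ p → x + + j ≡ y + + p
catch-up x y with compare-witness x y
... | inj₁ (p , y≡x+p)   = p , 0 , trans (sym y≡x+p) (sym (ℤₚ.+-identityʳ y))
... | inj₂ (p , x≡y+1+p) = 0 , suc p , trans (ℤₚ.+-identityʳ x) x≡y+1+p

data Outside (A B : ℤ) (n : ℕ) (x : ℤ) : Set where
  left  : ∀ d → A ≡ x + + n + + suc d → Outside A B n x
  right : ∀ d → x ≡ B + + n + + suc d → Outside A B n x

module _ {A B : ℤ} {n : ℕ} {x : ℤ} where

  private
    widen : ∀ y n s → y + (+ 1 + n) + s ≡ y + n + (+ 1 + s)
    widen = solve-∀

  Outside-suc : Outside A B (suc n) x → Outside A B n x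
  Outside-suc (left d eq)  = left (suc d) (trans eq (widen x (+ n) (+ suc d)))
  Outside-suc (right d eq) = right (suc d) (trans eq (widen B (+ n) (+ suc d)))

  Outside-right : Outside A B (suc n) x → Outside A B n (x + + 1)
  Outside-right (left d eq) = left d (trans eq (e x (+ n) (+ suc d)))
    where
    e : ∀ x n s → x + (+ 1 + n) + s ≡ x + + 1 + n + s
    e = solve-∀
  Outside-right (right d eq) = right (suc (suc d)) (trans (cong (_+ + 1) eq) (e B (+ n) (+ suc d)))
    where
    e : ∀ x n s → x + (+ 1 + n) + s + + 1 ≡ x + n + (+ 1 + (+ 1 + s))
    e = solve-∀

  Outside-left : Outside A B (suc n) x → Outside A B n (x - + 1)
  Outside-left (left d eq) = left (suc (suc d)) (trans eq (e x (+ n) (+ suc d)))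
    where
    e : ∀ x n s → x + (+ 1 + n) + s ≡ x - + 1 + n + (+ 1 + (+ 1 + s))
    e = solve-∀
  Outside-left (right d eq) = right d (trans (cong (_- + 1) eq) (e B (+ n) (+ suc d)))
    where
    e : ∀ x n s → x + (+ 1 + n) + s - + 1 ≡ x + n + s
    e = solve-∀

Outside-mir : ∀ {A B x} → Outside (- B) (- A) 0 x → Outside A B 0 (- x)
Outside-mir {A} {B} {x} (left d eq) =
  right d (trans (e₁ x (+ suc d)) (trans (cong (λ w → - w + + 0 + + suc d) (sym eq)) (e₂ B (+ suc d))))
  where
  e₁ : ∀ x s → - x ≡ - (x + + 0 + s) + + 0 + s
  e₁ = solve-∀
  e₂ : ∀ B s → - (- B) + + 0 + s ≡ B + + 0 + s
  e₂ = solve-∀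
Outside-mir {A} {B} {x} (right d eq) =
  left d (trans (e A (+ suc d)) (cong (λ w → - w + + 0 + + suc d) (sym eq)))
  where
  e : ∀ A s → A ≡ - (- A + + 0 + s) + + 0 + s
  e = solve-∀

module FinitelySupported {a b : ℤ → Bool} {A B : ℤ}
  (a-supp : ∀ x → Outside A B 0 x → a x ≡ false)
  (b-supp : ∀ x → Outside A B 0 x → b x ≡ false) where

  rows-light-cone : ∀ n x → Outside A B n x → rows a b n x ≡ false
  rows-light-cone zero          x out = a-supp x out
  rows-light-cone (suc zero)    x out = b-supp x (Outside-suc out)
  rows-light-cone (suc (suc n)) x out =
    cong₂ _xor_ (rows-light-cone n x (Outside-suc (Outside-suc out)))
      (cong₂ _xor_ (rows-light-cone (suc n) (x + + 1) (Outside-right out))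
        (cong₂ _xor_ (rows-light-cone (suc n) x (Outside-suc out)) (rows-light-cone (suc n) (x - + 1) (Outside-left out))))

-- The recurrence of Θ solved for the right neighbour, on columns C i of the space-time diagram:
-- two vanishing columns force zeros in the whole wedge to their right below the diagonal.
wedge-vanishes : (C : ℕ → ℕ → Bool) → (∀ n → C 0 n ≡ false) → (∀ n → C 1 n ≡ false) →
  (∀ i n → C (suc (suc i)) (suc n) ≡ C (suc i) (suc (suc n)) xor (C (suc i) n xor (C (suc i) (suc n) xor C i (suc n)))) →
  ∀ i n → i ≤ n → C i n ≡ false
wedge-vanishes C C₀ C₁ rec zero          n       _         = C₀ n
wedge-vanishes C C₀ C₁ rec (suc zero)    n       _         = C₁ n
wedge-vanishes C C₀ C₁ rec (suc (suc i)) (suc n) (s≤s i<n) =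
  trans (rec i n) (cong₂ _xor_ (wedge (suc i) (suc (suc n)) (ℕₚ.m≤n⇒m≤1+n (ℕₚ.m≤n⇒m≤1+n i<n)))
    (cong₂ _xor_ (wedge (suc i) n i<n)
      (cong₂ _xor_ (wedge (suc i) (suc n) (ℕₚ.m≤n⇒m≤1+n i<n))
                   (wedge i (suc n) (ℕₚ.m≤n⇒m≤1+n (ℕₚ.<⇒≤ i<n))))))
  where wedge = wedge-vanishes C C₀ C₁ rec

module FinitePeriodicRows {a b : ℤ → Bool} {A B : ℤ} (T′ : ℕ) {k : ℤ}
  (a-supp : ∀ x → Outside A B 0 x → a x ≡ false)
  (b-supp : ∀ x → Outside A B 0 x → b x ≡ false)
  (period₀ : ∀ x → rows a b (suc T′) x ≡ a (x - k))
  (period₁ : ∀ x → rows a b (suc (suc T′)) x ≡ b (x - k)) where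

  open FinitelySupported a-supp b-supp
  open PeriodicRows {a} {b} {suc T′} {k} period₀ period₁

  T : ℕ
  T = suc T′

  transport : ∀ j m y → rows a b (m ℕ.+ j ℕ.* T) (y + + j * k) ≡ rows a b m y
  transport j m y = trans (rows-periods j m _) (cong (rows a b m) (e y (+ j) k))
    where
    e : ∀ y j k → y + j * k - j * k ≡ y
    e = solve-∀

  -- k > T: every live cell is eventually carried out of the light cone of the support.
  faster-than-light : ∀ δ → k ≡ + (suc T ℕ.+ δ) → ∀ m y → rows a b m y ≢ true
  faster-than-light δ k≡ m y live with catch-up y (B + + suc m)
  ... | j , p , y+j≡ = not-¬ (rows-light-cone _ _ (right (p ℕ.+ j ℕ.* δ) moved)) (trans (transport j m y) live)
    where
    open ≡-Reasoning
    e₁ : ∀ y j t d → y + j * (+ 1 + t + d) ≡ y + j + j * t + j * d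
    e₁ = solve-∀
    e₂ : ∀ B m p jt jd → B + (+ 1 + m) + p + jt + jd ≡ B + (m + jt) + (+ 1 + (p + jd))
    e₂ = solve-∀
    moved : y + + j * k ≡ B + + (m ℕ.+ j ℕ.* T) + + suc (p ℕ.+ j ℕ.* δ)
    moved = begin
      y + + j * k                                         ≡⟨ cong (λ w → y + + j * w) k≡ ⟩
      y + + j * (+ 1 + + T + + δ)                         ≡⟨ e₁ y (+ j) (+ T) (+ δ) ⟩
      y + + j + + j * + T + + j * + δ                     ≡⟨ cong (λ w → w + + j * + T + + j * + δ) y+j≡ ⟩
      B + + suc m + + p + + j * + T + + j * + δ           ≡⟨ e₂ B (+ m) (+ p) (+ j * + T) (+ j * + δ) ⟩
      B + (+ m + + j * + T) + (+ 1 + (+ p + + j * + δ))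
        ≡⟨ cong₂ (λ u v → B + (+ m + u) + (+ 1 + (+ p + v))) (ℤₚ.pos-* j T) (ℤₚ.pos-* j δ) ⟨
      B + + (m ℕ.+ j ℕ.* T) + + suc (p ℕ.+ j ℕ.* δ)       ∎

  -- 0 ≤ k < T: cells left of A - T are never live, and solving the recurrence for the right
  -- neighbour spreads these zeros at the speed of light, overtaking every live cell.
  slower-than-light : ∀ k′ δ → k ≡ + k′ → suc k′ ℕ.+ δ ≡ T → ∀ m y → rows a b m y ≢ true
  slower-than-light k′ δ k≡ T≡ m y live with catch-up A (y + (+ 1 + (+ 1 + + k′ + + δ)))
  ... | j , p , A+j≡ = not-¬ (zero-below-diagonal (m ℕ.+ j ℕ.* T) (y + + j * k) (p ℕ.+ m ℕ.+ j ℕ.* δ) overtaken)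
                                  (trans (transport j m y) live)
    where
    open ≡-Reasoning
    K = + 1 + + k′ + + δ

    left-of-support : ∀ n x e → A ≡ x + + T + + e → rows a b n x ≡ false
    left-of-support n x e A≡ with ℕₚ.m≤n⇒∃[o]m+o≡n (m%n<n n T)
    ... | ε , r+ε≡ = begin
      rows a b n x                              ≡⟨ cong (λ t → rows a b t x) (m≡m%n+[m/n]*n n T) ⟩
      rows a b (r ℕ.+ q ℕ.* T) x                ≡⟨ rows-periods q r x ⟩
      rows a b r (x - + q * k)                  ≡⟨ rows-light-cone r _ (left (ε ℕ.+ e ℕ.+ q ℕ.* k′) shifted) ⟩
      false                                     ∎
      where
      q = n / T
      r = n % T
      e₁ : ∀ x r ε e q k → x + (+ 1 + r + ε) + e ≡ x - q * k + r + (+ 1 + (ε + e + q * k))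
      e₁ = solve-∀
      shifted : A ≡ x - + q * k + + r + + suc (ε ℕ.+ e ℕ.+ q ℕ.* k′)
      shifted = begin
        A                                                 ≡⟨ A≡ ⟩
        x + + T + + e                                     ≡⟨ cong (λ t → x + + t + + e) r+ε≡ ⟨
        x + (+ 1 + + r + + ε) + + e                       ≡⟨ e₁ x (+ r) (+ ε) (+ e) (+ q) (+ k′) ⟩
        x - + q * + k′ + + r + (+ 1 + (+ ε + + e + + q * + k′))
          ≡⟨ cong₂ (λ u v → x - + q * u + + r + (+ 1 + (+ ε + + e + v))) k≡ (ℤₚ.pos-* q k′) ⟨
        x - + q * k + + r + + suc (ε ℕ.+ e ℕ.+ q ℕ.* k′)  ∎

    x₀ = A - + T - + 1

    column : ℕ → ℕ → Bool
    column i n = rows a b n (x₀ + + i)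

    column₀ : ∀ n → column 0 n ≡ false
    column₀ n = left-of-support n _ 1 (e A (+ T))
      where
      e : ∀ A t → A ≡ A - t - + 1 + + 0 + t + + 1
      e = solve-∀

    column₁ : ∀ n → column 1 n ≡ false
    column₁ n = left-of-support n _ 0 (e A (+ T))
      where
      e : ∀ A t → A ≡ A - t - + 1 + + 1 + t + + 0
      e = solve-∀

    column-recurrence : ∀ i n → column (suc (suc i)) (suc n) ≡
      column (suc i) (suc (suc n)) xor (column (suc i) n xor (column (suc i) (suc n) xor column i (suc n)))
    column-recurrence i n = begin
      rows a b (suc n) (x₀ + + suc (suc i))     ≡⟨ cong (rows a b (suc n)) (e₁ x₀ (+ i)) ⟩
      rows a b (suc n) (X + + 1)
        ≡⟨ solve-right (rows a b n X) (rows a b (suc n) (X + + 1)) (rows a b (suc n) X xor rows a b (suc n) (X - + 1)) ⟩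
      rows a b (suc (suc n)) X xor (rows a b n X xor (rows a b (suc n) X xor rows a b (suc n) (X - + 1)))
        ≡⟨ cong (λ w → rows a b (suc (suc n)) X xor (rows a b n X xor (rows a b (suc n) X xor rows a b (suc n) w))) (e₂ x₀ (+ i)) ⟩
      column (suc i) (suc (suc n)) xor (column (suc i) n xor (column (suc i) (suc n) xor column i (suc n))) ∎
      where
      X = x₀ + + suc i
      e₁ : ∀ x i → x + (+ 1 + (+ 1 + i)) ≡ x + (+ 1 + i) + + 1
      e₁ = solve-∀
      e₂ : ∀ x i → x + (+ 1 + i) - + 1 ≡ x + i
      e₂ = solve-∀
      solve-right : ∀ a p q → p ≡ (a xor (p xor q)) xor (a xor q)
      solve-right = solve 3 (λ a p q → p := (a :+ (p :+ q)) :+ (a :+ q)) refl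
        where open xor-∧-Solver

    zero-below-diagonal : ∀ n x e → x₀ + + n ≡ x + + e → rows a b n x ≡ false
    zero-below-diagonal n x e x₀+n≡ with compare-witness x x₀
    ... | inj₁ (p , x₀≡) = left-of-support n x (suc p)
      (trans (e₁ A (+ T)) (trans (cong (λ w → w + + T + + 1) x₀≡) (e₂ x (+ p) (+ T))))
      where
      e₁ : ∀ A t → A ≡ A - t - + 1 + t + + 1
      e₁ = solve-∀
      e₂ : ∀ x p t → x + p + t + + 1 ≡ x + t + (+ 1 + p)
      e₂ = solve-∀
    ... | inj₂ (p , x≡) = trans (cong (rows a b n) x≡)
      (wedge-vanishes column column₀ column₁ column-recurrence (suc p) n (subst (suc p ≤_) (sym n≡) (ℕₚ.m≤m+n (suc p) e)))
      where
      cancel : ∀ x₀ n x e p → x₀ + n ≡ x + e → x ≡ x₀ + p → n ≡ p + e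
      cancel x₀ n x e p h₁ h₂ = trans (sym (e₁ x₀ n)) (trans (cong (_- x₀) h₁) (trans (cong (λ w → w + e - x₀) h₂) (e₂ x₀ p e)))
        where
        e₁ : ∀ x₀ n → x₀ + n - x₀ ≡ n
        e₁ = solve-∀
        e₂ : ∀ x₀ p e → x₀ + p + e - x₀ ≡ p + e
        e₂ = solve-∀
      n≡ : n ≡ suc p ℕ.+ e
      n≡ = ℤₚ.+-injective (cancel x₀ (+ n) x (+ e) (+ suc p) x₀+n≡ x≡)

    overtaken : x₀ + + (m ℕ.+ j ℕ.* T) ≡ y + + j * k + + (p ℕ.+ m ℕ.+ j ℕ.* δ)
    overtaken = begin
      A - + T - + 1 + (+ m + + (j ℕ.* T))            ≡⟨ cong (λ w → A - + T - + 1 + (+ m + w)) (ℤₚ.pos-* j T) ⟩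
      A - + T - + 1 + (+ m + + j * + T)              ≡⟨ cong (λ t → A - t - + 1 + (+ m + + j * t)) (cong +_ T≡) ⟨
      A - K - + 1 + (+ m + + j * K)                  ≡⟨ e₁ A (+ j) (+ k′) (+ δ) (+ m) ⟩
      A + + j - K - + 1 + + m + + j * (+ k′ + + δ)   ≡⟨ cong (λ w → w - K - + 1 + + m + + j * (+ k′ + + δ)) A+j≡ ⟩
      y + (+ 1 + K) + + p - K - + 1 + + m + + j * (+ k′ + + δ)   ≡⟨ e₂ y (+ p) (+ j) (+ k′) (+ δ) (+ m) ⟩
      y + + j * + k′ + (+ p + + m + + j * + δ)       ≡⟨ cong₂ (λ u v → y + + j * u + (+ p + + m + v)) k≡ (ℤₚ.pos-* j δ) ⟨
      y + + j * k + + (p ℕ.+ m ℕ.+ j ℕ.* δ)          ∎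
      where
      e₁ : ∀ A j k d m → A - (+ 1 + k + d) - + 1 + (m + j * (+ 1 + k + d)) ≡ A + j - (+ 1 + k + d) - + 1 + m + j * (k + d)
      e₁ = solve-∀
      e₂ : ∀ y p j k d m → y + (+ 1 + (+ 1 + k + d)) + p - (+ 1 + k + d) - + 1 + m + j * (k + d) ≡ y + j * k + (p + m + j * d)
      e₂ = solve-∀

  -- k = T: in the frame moving right at the speed of light the diagram is time-periodic, and its
  -- rightmost nonzero column is ruled out by LightSpeedColumns.
  module LightSpeed (k≡ : k ≡ + T) where

    Y : ℕ → ℤ → Bool
    Y n z = rows a b n (z + + n)

    Y-periods : ∀ q n z → Y (n ℕ.+ q ℕ.* T) z ≡ Y n z
    Y-periods q n z = trans (rows-periods q n _) (cong (rows a b n) (begin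
      z + (+ n + + (q ℕ.* T)) - + q * k         ≡⟨ cong₂ (λ u v → z + (+ n + u) - + q * v) (ℤₚ.pos-* q T) k≡ ⟩
      z + (+ n + + q * + T) - + q * + T         ≡⟨ e z (+ n) (+ q * + T) ⟩
      z + + n                                   ∎))
      where
      open ≡-Reasoning
      e : ∀ z n t → z + (n + t) - t ≡ z + n
      e = solve-∀

    Y-periodic : ∀ n z → Y (n ℕ.+ T) z ≡ Y n z
    Y-periodic n z = trans (cong (λ t → Y (n ℕ.+ t) z) (sym (ℕₚ.+-identityʳ T))) (Y-periods 1 n z)

    Y-right-zero : ∀ n z d → z ≡ B + + suc d → Y n z ≡ false
    Y-right-zero n z d z≡ = rows-light-cone n _ (right d (trans (cong (_+ + n) z≡) (e B (+ suc d) (+ n))))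
      where
      e : ∀ B s n → B + s + n ≡ B + n + s
      e = solve-∀

    Y-recurrence : ∀ n z → Y (suc (suc n)) z ≡ Y n (z + + 2) xor (Y (suc n) (z + + 2) xor (Y (suc n) (z + + 1) xor Y (suc n) z))
    Y-recurrence n z = cong₂ _xor_ (cong (rows a b n) (e₁ z (+ n)))
      (cong₂ _xor_ (cong (rows a b (suc n)) (e₂ z (+ n)))
        (cong₂ _xor_ (cong (rows a b (suc n)) (e₃ z (+ n))) (cong (rows a b (suc n)) (e₄ z (+ n)))))
      where
      e₁ : ∀ z n → z + (+ 2 + n) ≡ z + + 2 + n
      e₁ = solve-∀
      e₂ : ∀ z n → z + (+ 2 + n) + + 1 ≡ z + + 2 + (+ 1 + n)
      e₂ = solve-∀
      e₃ : ∀ z n → z + (+ 2 + n) ≡ z + + 1 + (+ 1 + n)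
      e₃ = solve-∀
      e₄ : ∀ z n → z + (+ 2 + n) - + 1 ≡ z + (+ 1 + n)
      e₄ = solve-∀

    column-dichotomy : ∀ z → (∀ n → Y n z ≡ false) ⊎ (Σ ℕ λ n → Y n z ≡ true)
    column-dichotomy z with Finₚ.all? (λ i → Y (toℕ i) z ≟ false)
    ... | yes vanishes-below-T = inj₁ λ n → begin
      Y n z                                  ≡⟨ cong (λ t → Y t z) (m≡m%n+[m/n]*n n T) ⟩
      Y (n % T ℕ.+ (n / T) ℕ.* T) z          ≡⟨ Y-periods (n / T) (n % T) z ⟩
      Y (n % T) z                            ≡⟨ cong (λ t → Y t z) (Finₚ.toℕ-fromℕ< (m%n<n n T)) ⟨
      Y (toℕ (fromℕ< (m%n<n n T))) z         ≡⟨ vanishes-below-T (fromℕ< (m%n<n n T)) ⟩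
      false                                  ∎
      where open ≡-Reasoning
    ... | no ¬vanishes-below-T with Finₚ.¬∀⟶∃¬ T _ (λ i → Y (toℕ i) z ≟ false) ¬vanishes-below-T
    ...   | i , Y≢false = inj₂ (toℕ i , ¬-not Y≢false)

    rightmost-live-column : ∀ d u → (∀ e n → Y n (u + + suc e) ≡ false) → (Σ ℕ λ n → Y n (u - + d) ≡ true) →
      Σ ℤ λ z → (Σ ℕ λ n → Y n z ≡ true) × (∀ e n → Y n (z + + suc e) ≡ false)
    rightmost-live-column zero    u right-zero (n , live) = u , (n , trans (cong (Y n) (sym (ℤₚ.+-identityʳ u))) live) , right-zero
    rightmost-live-column (suc d) u right-zero (n , live) with column-dichotomy u
    ... | inj₂ live-at-u  = u , live-at-u , right-zero
    ... | inj₁ vanishes-u = rightmost-live-column d (u - + 1) right-zero′ (n , trans (cong (Y n) (e u (+ d))) live)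
      where
      e : ∀ u d → u - + 1 - d ≡ u - (+ 1 + d)
      e = solve-∀
      e₀ : ∀ u → u - + 1 + + 1 ≡ u
      e₀ = solve-∀
      e₁ : ∀ u s → u - + 1 + (+ 1 + s) ≡ u + s
      e₁ = solve-∀
      right-zero′ : ∀ e n → Y n (u - + 1 + + suc e) ≡ false
      right-zero′ zero    n = trans (cong (Y n) (e₀ u)) (vanishes-u n)
      right-zero′ (suc e) n = trans (cong (Y n) (e₁ u (+ suc e))) (right-zero e n)

    light-speed : ∀ m y → rows a b m y ≢ true
    light-speed m y live with compare-witness (y - + m) B
    ... | inj₂ (p , y-m≡) = not-¬ (Y-right-zero m _ p y-m≡) (trans (cong (rows a b m) (e y (+ m))) live)
      where
      e : ∀ y m → y - m + m ≡ y
      e = solve-∀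
    ... | inj₁ (p , B≡) with rightmost-live-column p B (λ e n → Y-right-zero n _ e refl)
                               (m , trans (cong (Y m) (e B (y - + m) (+ p) B≡)) (trans (cong (rows a b m) (e′ y (+ m))) live))
      where
      e : ∀ B x p → B ≡ x + p → B - p ≡ x
      e B x p B≡ = trans (cong (_- p) B≡) (e″ x p)
        where
        e″ : ∀ x p → x + p - p ≡ x
        e″ = solve-∀
      e′ : ∀ y m → y - m + m ≡ y
      e′ = solve-∀
    ... | zs , (n , live-at-zs) , right-of-zs =
      LightSpeedColumns.impossible C T (s≤s z≤n) (λ j n → Y-periodic n (zs + + 2 - + j)) C₀ C₁ recurrence
        (n , trans (cong (Y n) (e zs)) live-at-zs)
      where
      C : ℕ → ℕ → Bool
      C j n = Y n (zs + + 2 - + j)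
      e : ∀ z → z + + 2 - + 2 ≡ z
      e = solve-∀
      C₀ : ∀ n → C 0 n ≡ false
      C₀ n = trans (cong (Y n) (ℤₚ.+-identityʳ (zs + + 2))) (right-of-zs 1 n)
      C₁ : ∀ n → C 1 n ≡ false
      C₁ n = trans (cong (Y n) (e₁ zs)) (right-of-zs 0 n)
        where
        e₁ : ∀ z → z + + 2 - + 1 ≡ z + + 1
        e₁ = solve-∀
      recurrence : ∀ j n → C (suc (suc j)) (suc (suc n)) ≡ C j n xor (C j (suc n) xor (C (suc j) (suc n) xor C (suc (suc j)) (suc n)))
      recurrence j n = trans (Y-recurrence n (zs + + 2 - + suc (suc j)))
        (cong₂ _xor_ (cong (Y n) (e₁ zs (+ j)))
          (cong₂ _xor_ (cong (Y (suc n)) (e₁ zs (+ j))) (cong (_xor C (suc (suc j)) (suc n)) (cong (Y (suc n)) (e₂ zs (+ j))))))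
        where
        e₁ : ∀ z j → z + + 2 - (+ 2 + j) + + 2 ≡ z + + 2 - j
        e₁ = solve-∀
        e₂ : ∀ z j → z + + 2 - (+ 2 + j) + + 1 ≡ z + + 2 - (+ 1 + j)
        e₂ = solve-∀

  nonnegative-drift : ∀ k′ → k ≡ + k′ → ∀ m y → rows a b m y ≢ true
  nonnegative-drift k′ k≡ with ℕₚ.<-cmp T k′
  ... | tri≈ _ refl _ = LightSpeed.light-speed k≡
  ... | tri< T<k′ _ _ with ℕₚ.m≤n⇒∃[o]m+o≡n T<k′
  ...   | δ , T+δ≡ = faster-than-light δ (trans k≡ (cong +_ (sym T+δ≡)))
  nonnegative-drift k′ k≡ | tri> _ _ k′<T with ℕₚ.m≤n⇒∃[o]m+o≡n k′<T
  ...   | δ , k′+δ≡ = slower-than-light k′ δ k≡ k′+δ≡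

-- Negative drift reduces to positive drift by reflecting space.
finite-periodic-rows-vanish : ∀ {a b : ℤ → Bool} {A B : ℤ} (T′ : ℕ) {k : ℤ} →
  (∀ x → Outside A B 0 x → a x ≡ false) → (∀ x → Outside A B 0 x → b x ≡ false) →
  (∀ x → rows a b (suc T′) x ≡ a (x - k)) → (∀ x → rows a b (suc (suc T′)) x ≡ b (x - k)) →
  ∀ m y → rows a b m y ≢ true
finite-periodic-rows-vanish T′ {+ k′} a-supp b-supp period₀ period₁ =
  FinitePeriodicRows.nonnegative-drift T′ a-supp b-supp period₀ period₁ k′ refl
finite-periodic-rows-vanish {a} {b} T′ { -[1+ k″ ]} a-supp b-supp period₀ period₁ m y live =
  FinitePeriodicRows.nonnegative-drift T′ (λ x → a-supp (- x) ∘ Outside-mir) (λ x → b-supp (- x) ∘ Outside-mir)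
    (mirrored a {suc T′} period₀) (mirrored b {suc (suc T′)} period₁) (suc k″) refl m (- y)
    (trans (rows-mir a b m (- y)) (trans (cong (rows a b m) (ℤₚ.neg-involutive y)) live))
  where
  e : ∀ x k → - x - - k ≡ - (x - k)
  e = solve-∀
  mirrored : ∀ f {t} → (∀ x → rows a b t x ≡ f (x - -[1+ k″ ])) → ∀ x → rows (mir a) (mir b) t x ≡ mir f (x - + suc k″)
  mirrored f {t} period x = trans (rows-mir a b t x) (trans (period (- x)) (cong f (e x (+ suc k″))))

xor-≢-true : ∀ {x y} → x xor y ≢ true → x ≡ y
xor-≢-true {false} {false} _ = refl
xor-≢-true {false} {true}  h = ⊥-elim (h refl)
xor-≢-true {true}  {false} h = ⊥-elim (h refl)
xor-≢-true {true}  {true}  _ = refl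

-- Θ is linear, so the difference of two orbits with the same period and drift is again one,
-- and it is finitely supported when the orbits differ in finitely many cells.
periodic-configurations-agree : ∀ {E E′ : Config (Vec Bool 2)} {A B : ℤ} {T′ : ℕ} {k : ℤ} →
  (∀ x → iterate (suc T′) Θ E x ≡ E (x - k)) → (∀ x → iterate (suc T′) Θ E′ x ≡ E′ (x - k)) →
  (∀ x → Outside A B 0 x → E x ≡ E′ x) → ∀ x → E x ≡ E′ x
periodic-configurations-agree {E} {E′} {T′ = T′} {k} E-periodic E′-periodic agree x = begin
  E x                          ≡⟨ pair-η (E x) ⟨
  π₀ (E x) ∷ π₁ (E x) ∷ []     ≡⟨ cong₂ (λ p q → p ∷ q ∷ []) (xor-≢-true (vanish 0 x)) (xor-≢-true (vanish 1 x)) ⟩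
  π₀ (E′ x) ∷ π₁ (E′ x) ∷ []   ≡⟨ pair-η (E′ x) ⟩
  E′ x                         ∎
  where
  open ≡-Reasoning
  a b : ℤ → Bool
  a y = π₀ (E y) xor π₀ (E′ y)
  b y = π₁ (E y) xor π₁ (E′ y)
  rows-of : ∀ F → (∀ y → iterate (suc T′) Θ F y ≡ F (y - k)) → ∀ y →
    rows (π₀ ∘ F) (π₁ ∘ F) (suc T′) y ≡ π₀ (F (y - k)) × rows (π₀ ∘ F) (π₁ ∘ F) (suc (suc T′)) y ≡ π₁ (F (y - k))
  rows-of F F-periodic y = trans (sym (cong π₀ (iterate-Θ F (suc T′) y))) (cong π₀ (F-periodic y)) ,
                           trans (sym (cong π₁ (iterate-Θ F (suc T′) y))) (cong π₁ (F-periodic y))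
  vanish = finite-periodic-rows-vanish T′
    (λ y out → trans (cong (λ v → π₀ v xor π₀ (E′ y)) (agree y out)) (xor-same (π₀ (E′ y))))
    (λ y out → trans (cong (λ v → π₁ v xor π₁ (E′ y)) (agree y out)) (xor-same (π₁ (E′ y))))
    (λ y → trans (rows-xor (π₀ ∘ E) (π₁ ∘ E) (π₀ ∘ E′) (π₁ ∘ E′) (suc T′) y)
                 (cong₂ _xor_ (proj₁ (rows-of E E-periodic y)) (proj₁ (rows-of E′ E′-periodic y))))
    (λ y → trans (rows-xor (π₀ ∘ E) (π₁ ∘ E) (π₀ ∘ E′) (π₁ ∘ E′) (suc (suc T′)) y)
                 (cong₂ _xor_ (proj₂ (rows-of E E-periodic y)) (proj₂ (rows-of E′ E′-periodic y))))

module _ {A : Set} {F : GMap A} (F-cong : Congruent F) where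

  iterate-cong : ∀ t → Congruent (iterate t F)
  iterate-cong zero    c≗c′ x = c≗c′ x
  iterate-cong (suc t) c≗c′ x = F-cong (iterate-cong t c≗c′) x

  iterate-+ : ∀ s t c x → iterate (s ℕ.+ t) F c x ≡ iterate s F (iterate t F c) x
  iterate-+ zero    t c x = refl
  iterate-+ (suc s) t c x = F-cong (iterate-+ s t c) x

iterate-id : ∀ {A : Set} t (c : Config A) x → iterate t id c x ≡ c x
iterate-id zero    c x = refl
iterate-id (suc t) c x = iterate-id t c x

iterate-Θ-shift : ∀ t z c x → iterate t Θ (shift z c) x ≡ iterate t Θ c (x - z)
iterate-Θ-shift zero    z c x = refl
iterate-Θ-shift (suc t) z c x = trans (Θ-cong (iterate-Θ-shift t z c) x) (Θ-shift z (iterate t Θ c) x)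

module Blocks (m : ℕ) {{_ : NonZero m}} where

  unpack-cong : ∀ {A : Set} {c c′ : Config (Vec A m)} → (∀ y → c y ≡ c′ y) → ∀ x → unpack m c x ≡ unpack m c′ x
  unpack-cong c≗c′ x = cong (λ v → lookup v (fromℕ< (n%ℕd<d x m))) (c≗c′ (x /ℕ m))

  unpack-pack : ∀ {A : Set} (c : Config A) x → unpack m (pack m c) x ≡ c x
  unpack-pack c x = begin
    lookup (pack m c (x /ℕ m)) (fromℕ< (n%ℕd<d x m))     ≡⟨ Vecₚ.lookup∘tabulate _ (fromℕ< (n%ℕd<d x m)) ⟩
    c (+ m * (x /ℕ m) + + toℕ (fromℕ< (n%ℕd<d x m)))
      ≡⟨ cong (λ r → c (+ m * (x /ℕ m) + + r)) (Finₚ.toℕ-fromℕ< (n%ℕd<d x m)) ⟩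
    c (+ m * (x /ℕ m) + + (x %ℕ m))                     ≡⟨ cong c (e (+ m) (x /ℕ m) (+ (x %ℕ m))) ⟩
    c (+ (x %ℕ m) + (x /ℕ m) * + m)                      ≡⟨ cong c (a≡a%ℕn+[a/ℕn]*n x m) ⟨
    c x                                                  ∎
    where
    open ≡-Reasoning
    e : ∀ m q r → m * q + r ≡ r + q * m
    e = solve-∀

  remainder-too-large : ∀ {r r′ p q} → r < m → + r + q * + m ≡ + r′ + (q + + suc p) * + m → ⊥
  remainder-too-large {r} {r′} {p} {q} r<m eq =
    ℕₚ.<⇒≱ r<m (subst (m ≤_) (sym r≡) (ℕₚ.≤-trans (ℕₚ.m≤m+n m (p ℕ.* m)) (ℕₚ.m≤n+m _ r′)))
    where
    cancel : ∀ r r′ q s m → r + q * m ≡ r′ + (q + s) * m → r ≡ r′ + s * m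
    cancel r r′ q s m h = trans (e₁ r q m) (trans (cong (λ w → w - q * m) h) (e₂ r′ q s m))
      where
      e₁ : ∀ r q m → r ≡ r + q * m - q * m
      e₁ = solve-∀
      e₂ : ∀ r′ q s m → r′ + (q + s) * m - q * m ≡ r′ + s * m
      e₂ = solve-∀
    r≡ : r ≡ r′ ℕ.+ (m ℕ.+ p ℕ.* m)
    r≡ = ℤₚ.+-injective (trans (cancel (+ r) (+ r′) q (+ suc p) (+ m) eq) (cong (λ w → + r′ + w) (sym (ℤₚ.pos-* (suc p) m))))

  quotient-unique : ∀ {r r′ q q′} → r < m → r′ < m → + r + q * + m ≡ + r′ + q′ * + m → q ≡ q′
  quotient-unique {r} {r′} {q} {q′} r<m r′<m eq with compare-witness q q′
  ... | inj₁ (zero , q′≡)  = sym (trans q′≡ (ℤₚ.+-identityʳ q))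
  ... | inj₁ (suc p , q′≡) = ⊥-elim (remainder-too-large {r} {r′} {p} {q} r<m (trans eq (cong (λ w → + r′ + w * + m) q′≡)))
  ... | inj₂ (p , q≡)      = ⊥-elim (remainder-too-large {r′} {r} {p} {q′} r′<m (trans (sym eq) (cong (λ w → + r + w * + m) q≡)))

  unpack-at : ∀ {A : Set} (c : Config (Vec A m)) y i (i<m : i < m) → unpack m c (+ m * y + + i) ≡ lookup (c y) (fromℕ< i<m)
  unpack-at c y i i<m = cong₂ lookup (cong c q≡y) (Finₚ.toℕ-injective (begin
    toℕ (fromℕ< (n%ℕd<d X m))   ≡⟨ Finₚ.toℕ-fromℕ< _ ⟩
    X %ℕ m                      ≡⟨ r≡i ⟩
    i                           ≡⟨ Finₚ.toℕ-fromℕ< i<m ⟨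
    toℕ (fromℕ< i<m)            ∎))
    where
    open ≡-Reasoning
    X = + m * y + + i
    e₁ : ∀ m y i → m * y + i ≡ i + y * m
    e₁ = solve-∀
    decomposition : + (X %ℕ m) + (X /ℕ m) * + m ≡ + i + y * + m
    decomposition = trans (sym (a≡a%ℕn+[a/ℕn]*n X m)) (e₁ (+ m) y (+ i))
    q≡y : X /ℕ m ≡ y
    q≡y = quotient-unique (n%ℕd<d X m) i<m decomposition
    e₂ : ∀ r q m → r ≡ r + q * m - q * m
    e₂ = solve-∀
    r≡i : X %ℕ m ≡ i
    r≡i = ℤₚ.+-injective (begin
      + (X %ℕ m)                                  ≡⟨ e₂ (+ (X %ℕ m)) (X /ℕ m) (+ m) ⟩
      + (X %ℕ m) + (X /ℕ m) * + m - (X /ℕ m) * + m ≡⟨ cong₂ (λ u v → u - v * + m) decomposition q≡y ⟩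
      + i + y * + m - y * + m                      ≡⟨ e₂ (+ i) y (+ m) ⟨
      + i                                          ∎)

  pack-unpack : ∀ {A : Set} (c : Config (Vec A m)) y → pack m (unpack m c) y ≡ c y
  pack-unpack c y = trans (Vecₚ.tabulate-cong λ i → trans (unpack-at c y (toℕ i) (Finₚ.toℕ<n i))
                                                          (cong (lookup (c y)) (Finₚ.fromℕ<-toℕ i (Finₚ.toℕ<n i))))
                          (Vecₚ.tabulate∘lookup (c y))

  unpack-shift : ∀ {A : Set} (c : Config (Vec A m)) z x → unpack m (shift z c) x ≡ unpack m c (x - + m * z)
  unpack-shift c z x = sym (trans (cong (unpack m c) block-form) (unpack-at c (x /ℕ m - z) (x %ℕ m) (n%ℕd<d x m)))
    where
    e : ∀ x m z q r → x ≡ r + q * m → x - m * z ≡ m * (q - z) + r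
    e x m z q r x≡ = trans (cong (λ w → w - m * z) x≡) (e′ m z q r)
      where
      e′ : ∀ m z q r → r + q * m - m * z ≡ m * (q - z) + r
      e′ = solve-∀
    block-form : x - + m * z ≡ + m * (x /ℕ m - z) + + (x %ℕ m)
    block-form = e x (+ m) z (x /ℕ m) (+ (x %ℕ m)) (a≡a%ℕn+[a/ℕn]*n x m)

  outside-first-block : ∀ x → Outside (+ 0) (+ m - + 1) 0 x → x /ℕ m ≢ + 0
  outside-first-block x out q≡0 = remainder-in-range out (n%ℕd<d x m)
    (trans (a≡a%ℕn+[a/ℕn]*n x m) (trans (cong (λ q → + (x %ℕ m) + q * + m) q≡0) (ℤₚ.+-identityʳ _)))
    where
    remainder-in-range : ∀ {x r} → Outside (+ 0) (+ m - + 1) 0 x → r < m → x ≡ + r → ⊥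
    remainder-in-range {r = r} (left d 0≡) _ refl = ℕₚ.m+1+n≢0 (r ℕ.+ 0) (sym (ℤₚ.+-injective 0≡))
    remainder-in-range {r = r} (right d r≡) r<m refl =
      ℕₚ.<⇒≱ r<m (subst (m ≤_) (sym (ℤₚ.+-injective (trans r≡ (e (+ m) (+ d))))) (ℕₚ.m≤m+n m d))
      where
      e : ∀ m d → m - + 1 + + 0 + (+ 1 + d) ≡ m + d
      e = solve-∀

module SimulatedIdentity {S : Set} (m₁ m₂ : ℕ) {{_ : NonZero m₁}} {{_ : NonZero m₂}} (t₁ t₂ : ℕ) (z₁ z₂ : ℤ)
  (φ : Vec S m₁ → Vec (Vec Bool 2) m₂) (φ-injective : Injective _≡_ _≡_ φ)
  (φ-commutes : ∀ c x → φ (rescale (idCA S) m₁ t₁ z₁ c x) ≡ rescale Θ m₂ t₂ z₂ (φ ∘ c) x) where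

  private
    module B₁ = Blocks m₁
    module B₂ = Blocks m₂

  G : GMap (Vec S m₁)
  G = rescale (idCA S) m₁ t₁ z₁

  G-unfold : ∀ c y → G c y ≡ pack m₁ (shift z₁ (unpack m₁ c)) y
  G-unfold c y = Vecₚ.tabulate-cong λ i → iterate-id t₁ (unpack m₁ c) (+ m₁ * y + + toℕ i - z₁)

  G-cong : Congruent G
  G-cong {c} {c′} c≗c′ y = trans (G-unfold c y)
    (trans (Vecₚ.tabulate-cong λ i → B₁.unpack-cong c≗c′ (+ m₁ * y + + toℕ i - z₁)) (sym (G-unfold c′ y)))

  G-iterate : ∀ j c y → iterate j G c y ≡ pack m₁ (shift (+ j * z₁) (unpack m₁ c)) y
  G-iterate zero    c y =
    sym (trans (Vecₚ.tabulate-cong λ i → cong (unpack m₁ c) (e (+ m₁ * y + + toℕ i) z₁)) (B₁.pack-unpack c y))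
    where
    e : ∀ x z → x - + 0 * z ≡ x
    e = solve-∀
  G-iterate (suc j) c y = begin
    G (iterate j G c) y                         ≡⟨ G-cong (G-iterate j c) y ⟩
    G (pack m₁ (shift (+ j * z₁) (unpack m₁ c))) y  ≡⟨ G-unfold (pack m₁ (shift (+ j * z₁) (unpack m₁ c))) y ⟩
    pack m₁ (shift z₁ (unpack m₁ (pack m₁ (shift (+ j * z₁) (unpack m₁ c))))) y
      ≡⟨ Vecₚ.tabulate-cong (λ i → trans (B₁.unpack-pack (shift (+ j * z₁) (unpack m₁ c)) (+ m₁ * y + + toℕ i - z₁))
                                          (cong (unpack m₁ c) (e (+ m₁ * y + + toℕ i) z₁ (+ j)))) ⟩
    pack m₁ (shift (+ suc j * z₁) (unpack m₁ c)) y  ∎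
    where
    open ≡-Reasoning
    e : ∀ x z j → x - z - j * z ≡ x - (+ 1 + j) * z
    e = solve-∀

  G-period : ∀ c y → iterate m₁ G c y ≡ c (y - z₁)
  G-period c y = trans (G-iterate m₁ c y)
    (trans (Vecₚ.tabulate-cong λ i → cong (unpack m₁ c) (e (+ m₁) y (+ toℕ i) z₁)) (B₁.pack-unpack c (y - z₁)))
    where
    e : ∀ m y i z → m * y + i - m * z ≡ m * (y - z) + i
    e = solve-∀

  image : Config (Vec S m₁) → Config (Vec Bool 2)
  image c = unpack m₂ (φ ∘ c)

  image-iterate : ∀ j c x → image (iterate j G c) x ≡ iterate (j ℕ.* t₂) Θ (image c) (x - + j * z₂)
  image-iterate zero    c x = cong (image c) (e x z₂)
    where
    e : ∀ x z → x ≡ x - + 0 * z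
    e = solve-∀
  image-iterate (suc j) c x = begin
    image (G (iterate j G c)) x                                     ≡⟨ B₂.unpack-cong (φ-commutes (iterate j G c)) x ⟩
    unpack m₂ (pack m₂ (shift z₂ (iterate t₂ Θ (image (iterate j G c))))) x
      ≡⟨ B₂.unpack-pack (shift z₂ (iterate t₂ Θ (image (iterate j G c)))) x ⟩
    iterate t₂ Θ (image (iterate j G c)) (x - z₂)                   ≡⟨ iterate-cong Θ-cong t₂ (image-iterate j c) (x - z₂) ⟩
    iterate t₂ Θ (shift (+ j * z₂) (iterate (j ℕ.* t₂) Θ (image c))) (x - z₂)
      ≡⟨ iterate-Θ-shift t₂ (+ j * z₂) _ (x - z₂) ⟩
    iterate t₂ Θ (iterate (j ℕ.* t₂) Θ (image c)) (x - z₂ - + j * z₂) ≡⟨ iterate-+ Θ-cong t₂ (j ℕ.* t₂) (image c) _ ⟨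
    iterate (suc j ℕ.* t₂) Θ (image c) (x - z₂ - + j * z₂)
      ≡⟨ cong (iterate (suc j ℕ.* t₂) Θ (image c)) (e x z₂ (+ j)) ⟩
    iterate (suc j ℕ.* t₂) Θ (image c) (x - + suc j * z₂)           ∎
    where
    open ≡-Reasoning
    e : ∀ x z j → x - z - j * z ≡ x - (+ 1 + j) * z
    e = solve-∀

  drift : ℤ
  drift = + m₂ * z₁ - + m₁ * z₂

  image-periodic : ∀ c x → iterate (m₁ ℕ.* t₂) Θ (image c) x ≡ image c (x - drift)
  image-periodic c x = begin
    iterate (m₁ ℕ.* t₂) Θ (image c) x                       ≡⟨ cong (iterate (m₁ ℕ.* t₂) Θ (image c)) (e₁ x (+ m₁) z₂) ⟩
    iterate (m₁ ℕ.* t₂) Θ (image c) (x + + m₁ * z₂ - + m₁ * z₂) ≡⟨ image-iterate m₁ c (x + + m₁ * z₂) ⟨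
    image (iterate m₁ G c) (x + + m₁ * z₂)                  ≡⟨ B₂.unpack-cong (cong φ ∘ G-period c) (x + + m₁ * z₂) ⟩
    unpack m₂ (shift z₁ (φ ∘ c)) (x + + m₁ * z₂)            ≡⟨ B₂.unpack-shift (φ ∘ c) z₁ (x + + m₁ * z₂) ⟩
    image c (x + + m₁ * z₂ - + m₂ * z₁)                     ≡⟨ cong (image c) (e₂ x (+ m₁) z₂ (+ m₂) z₁) ⟩
    image c (x - drift)                                     ∎
    where
    open ≡-Reasoning
    e₁ : ∀ x m z → x ≡ x + m * z - m * z
    e₁ = solve-∀
    e₂ : ∀ x m₁ z₂ m₂ z₁ → x + m₁ * z₂ - m₂ * z₁ ≡ x - (m₂ * z₁ - m₁ * z₂)
    e₂ = solve-∀

  image-local : ∀ {c c′} → (∀ y → y ≢ + 0 → c y ≡ c′ y) → ∀ x → Outside (+ 0) (+ m₂ - + 1) 0 x → image c x ≡ image c′ x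
  image-local c≗c′ x out = cong (λ v → lookup (φ v) (fromℕ< (n%ℕd<d x m₂))) (c≗c′ _ (B₂.outside-first-block x out))

  image-at-origin : ∀ c (i : Fin m₂) → image c (+ toℕ i) ≡ lookup (φ (c (+ 0))) i
  image-at-origin c i = begin
    image c (+ toℕ i)                         ≡⟨ cong (image c) (e (+ m₂) (+ toℕ i)) ⟨
    image c (+ m₂ * + 0 + + toℕ i)            ≡⟨ B₂.unpack-at (φ ∘ c) (+ 0) (toℕ i) (Finₚ.toℕ<n i) ⟩
    lookup (φ (c (+ 0))) (fromℕ< _)           ≡⟨ cong (lookup (φ (c (+ 0)))) (Finₚ.fromℕ<-toℕ i (Finₚ.toℕ<n i)) ⟩
    lookup (φ (c (+ 0))) i                    ∎
    where
    open ≡-Reasoning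
    e : ∀ m i → m * + 0 + i ≡ i
    e = solve-∀

  image-determines-origin : ∀ {c c′} → (∀ x → image c x ≡ image c′ x) → c (+ 0) ≡ c′ (+ 0)
  image-determines-origin {c} {c′} c≈c′ = φ-injective (begin
    φ (c (+ 0))                        ≡⟨ Vecₚ.tabulate∘lookup _ ⟨
    tabulate (lookup (φ (c (+ 0))))
      ≡⟨ Vecₚ.tabulate-cong (λ i → trans (sym (image-at-origin c i)) (trans (c≈c′ (+ toℕ i)) (image-at-origin c′ i))) ⟩
    tabulate (lookup (φ (c′ (+ 0))))   ≡⟨ Vecₚ.tabulate∘lookup _ ⟩
    φ (c′ (+ 0))                       ∎)
    where open ≡-Reasoning

Θ-does-not-simulate-identity : ∀ n → 2 ≤ n → ¬ Simulates Θ (idCA (Fin n))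
Θ-does-not-simulate-identity (suc zero) (s≤s ())
Θ-does-not-simulate-identity (suc (suc n)) _ (zero , nz , _) = NonZero.nonZero nz
Θ-does-not-simulate-identity (suc (suc n)) _ (suc _ , _ , zero , nz , _) = NonZero.nonZero nz
Θ-does-not-simulate-identity (suc (suc n)) _ (suc _ , _ , suc _ , _ , _ , zero , _ , _ , _ , () , _)
Θ-does-not-simulate-identity (suc (suc n)) _
  (suc m₁′ , _ , suc m₂′ , _ , t₁ , suc t₂′ , z₁ , z₂ , _ , _ , φ , φ-injective , φ-commutes) =
  contradiction (cong head (image-determines-origin {marked} {constant} images-agree)) λ ()
  where
  open SimulatedIdentity (suc m₁′) (suc m₂′) t₁ (suc t₂′) z₁ z₂ φ φ-injective φ-commutes

  constant marked : Config (Vec (Fin (suc (suc n))) (suc m₁′))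
  constant _ = replicate _ Fin.zero
  marked y with y ℤ.≟ + 0
  ... | yes _ = replicate _ (Fin.suc Fin.zero)
  ... | no  _ = replicate _ Fin.zero

  marked-elsewhere : ∀ y → y ≢ + 0 → marked y ≡ constant y
  marked-elsewhere y y≢0 with y ℤ.≟ + 0
  ... | yes y≡0 = ⊥-elim (y≢0 y≡0)
  ... | no  _   = refl

  images-agree : ∀ x → image marked x ≡ image constant x
  images-agree = periodic-configurations-agree {T′ = t₂′ ℕ.+ m₁′ ℕ.* suc t₂′}
    (image-periodic marked) (image-periodic constant) (image-local marked-elsewhere)

proposition1 : Simulates Θ (mirrorCA Θ)
    × (∀ (Θinv : GMap (Vec Bool 2)) → (Θ ∘ Θinv) ≗ᶜ id → (Θinv ∘ Θ) ≗ᶜ id →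
    Simulates Θ Θinv × Simulates Θ (mirrorCA Θinv))
    × (∀ (n : ℕ) → 2 ≤ n → ¬ Simulates Θ (idCA (Fin n)))
proposition1 = Θ-simulates-mirror , (λ Θinv Θ∘Θinv≗id _ → Θ-simulates-inverse Θinv Θ∘Θinv≗id) , Θ-does-not-simulate-identity
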